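{- If a Boolean function $f$ is computable by a read-once DeMorgan formula, then $f$ is computable by a once-appearance branching program (oaBP).
   Context: A read-once DeMorgan formula is a tree whose leaves are literals $x_i$ or $\lnot x_i$ and whose inner nodes are binary $\land$/$\lor$ gates, such that each variable appears in at most one leaf. A branching program (BP) on Boolean variables is a directed acyclic graph with one source and two sinks labeled $0$ and $1$; each non-sink node is labeled by a variable and has two outgoing edges labeled $0$ and $1$; it computes by following, from the source, the edge labeled with the current node's variable value until a sink is reached. A once-appearance branching program (oaBP) is a BP in which the variable labels of the non-sink nodes are pairwise distinct. -}

module Defs where

open import Data.Nat using (ℕ; suc; _≤_)
open import Data.Fin using (Fin; toℕ)
open import Data.Bool using (Bool; not; _∧_; _∨_)
open import Data.List using (List; []; [_]; _++_)
open import Data.List.Relation.Unary.Unique.Propositional using (Unique)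
open import Relation.Binary.PropositionalEquality using (_≡_)
open import Function.Definitions using (Injective)

BoolFun : ℕ → Set
BoolFun n = (Fin n → Bool) → Bool

data Formula (n : ℕ) : Set where
  pos  : Fin n → Formula n
  neg  : Fin n → Formula n
  and  : Formula n → Formula n → Formula n
  or   : Formula n → Formula n → Formula n

evalF : ∀ {n} → Formula n → BoolFun n
evalF (pos i)   x = x i
evalF (neg i)   x = not (x i)
evalF (and φ ψ) x = evalF φ x ∧ evalF ψ x
evalF (or φ ψ)  x = evalF φ x ∨ evalF ψ x

vars : ∀ {n} → Formula n → List (Fin n)
vars (pos i)   = [ i ]
vars (neg i)   = [ i ]
vars (and φ ψ) = vars φ ++ vars ψ
vars (or φ ψ)  = vars φ ++ vars ψ

ReadOnce : ∀ {n} → Formula n → Set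
ReadOnce φ = Unique (vars φ)

-- Non-sink nodes are Fin m, numbered in a topological order: every edge
-- out of node i goes to a sink or to a node j with i < j (so the graph is
-- a DAG).

data Target (m : ℕ) (k : ℕ) : Set where
  sink : Bool → Target m k
  node : (j : Fin m) → k ≤ toℕ j → Target m k

record BP (n : ℕ) : Set where
  field
    size   : ℕ
    label  : Fin size → Fin n
    edge   : (i : Fin size) → Bool → Target size (suc (toℕ i))
    source : Target size 0

open BP public

data Run {n : ℕ} (P : BP n) (x : Fin n → Bool) : ∀ {k} → Target (size P) k → Bool → Set where
  atSink : ∀ {k} b → Run P x {k} (sink b) b
  step   : ∀ {k} (j : Fin (size P)) (p : k ≤ toℕ j) {b} →
           Run P x (edge P j (x (label P j))) b → Run P x (node j p) b

ComputesBP : ∀ {n} → BP n → BoolFun n → Set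
ComputesBP P f = ∀ x → Run P x (source P) (f x)

OnceAppearance : ∀ {n} → BP n → Set
OnceAppearance P = Injective _≡_ _≡_ (label P)

{-# OPTIONS --safe #-}

-- Build the program leaf by leaf: a literal is a single node, and φ ∧ ψ is
-- the program of φ whose 1-sink is rerouted into the source of the program
-- of ψ (dually, the 0-sink for φ ∨ ψ).  Numbering the nodes of ψ after those
-- of φ keeps every edge pointing forward, and the nodes are in bijection with
-- the leaves, so the node labels are distinct when the formula is read-once.
module Submission where

open import Defs
open import Data.Nat using (ℕ; zero; suc; _+_; _≤_; z≤n)
open import Data.Nat.Properties using (≤-trans; ≤-reflexive; m≤m+n; +-suc; +-monoʳ-≤)
open import Data.Fin using (Fin; toℕ; _↑ˡ_; _↑ʳ_) renaming (zero to fzero; suc to fsuc)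
open import Data.Fin.Properties using (toℕ-↑ˡ; toℕ-↑ʳ; toℕ<n)
open import Data.Bool using (Bool; true; false; not; _∧_; _∨_)
open import Data.List using (List; []; _∷_; _++_)
import Data.List.Relation.Unary.All as All
import Data.List.Relation.Unary.All.Properties as All
open import Data.List.Relation.Unary.AllPairs using ([]; _∷_)
open import Data.List.Relation.Unary.Any using (here; there)
open import Data.List.Relation.Unary.Unique.Propositional using (Unique)
open import Data.List.Relation.Binary.Disjoint.Propositional using (Disjoint)
open import Data.List.Membership.Propositional using (_∈_)
open import Data.List.Membership.Propositional.Properties using (∈-++⁺ˡ; ∈-++⁺ʳ)
open import Data.Vec.Functional using () renaming (_++_ to _++ᵛ_)
open import Data.Vec.Functional.Properties using (lookup-++ˡ; lookup-++ʳ)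
open import Data.Empty using (⊥-elim)
open import Data.Product using (Σ; _×_; _,_)
open import Function using (id)
open import Function.Definitions using (Injective)
open import Level using (Level)
open import Relation.Binary.PropositionalEquality
  using (_≡_; _≢_; refl; sym; trans; cong; subst)

private
  variable
    ℓ : Level
    A : Set ℓ
    k k′ n : ℕ

Unique-++⁻ : (xs : List A) {ys : List A} → Unique (xs ++ ys) →
             Unique xs × Unique ys × Disjoint xs ys
Unique-++⁻ []       ys!                = [] , ys! , λ ()
Unique-++⁻ (x ∷ xs) (x∉xs++ys ∷ xs++ys!)
  with Unique-++⁻ xs xs++ys! | All.++⁻ xs x∉xs++ys
... | xs! , ys! , xs#ys | x∉xs , x∉ys = x∉xs ∷ xs! , ys! , λ
  { (here refl  , v∈ys) → All.lookup x∉ys v∈ys refl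
  ; (there v∈xs , v∈ys) → xs#ys (v∈xs , v∈ys)
  }

data SplitView (m m′ : ℕ) : Fin (m + m′) → Set where
  left  : (a : Fin m)  → SplitView m m′ (a ↑ˡ m′)
  right : (j : Fin m′) → SplitView m m′ (m ↑ʳ j)

splitView : ∀ m {m′} (i : Fin (m + m′)) → SplitView m m′ i
splitView zero    i        = right i
splitView (suc m) fzero    = left fzero
splitView (suc m) (fsuc i) with splitView m i
... | left a  = left (fsuc a)
... | right j = right j

splitView-↑ˡ : ∀ {m} m′ (a : Fin m) → splitView m (a ↑ˡ m′) ≡ left a
splitView-↑ˡ m′ fzero    = refl
splitView-↑ˡ m′ (fsuc a) rewrite splitView-↑ˡ m′ a = refl

splitView-↑ʳ : ∀ m {m′} (j : Fin m′) → splitView m (m ↑ʳ j) ≡ right j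
splitView-↑ʳ zero    j = refl
splitView-↑ʳ (suc m) j rewrite splitView-↑ʳ m j = refl

++ᵛ-injective : {m m′ : ℕ} {f : Fin m → A} {g : Fin m′ → A} →
                Injective _≡_ _≡_ f → Injective _≡_ _≡_ g → (∀ a j → f a ≢ g j) →
                Injective _≡_ _≡_ (f ++ᵛ g)
++ᵛ-injective {m = m} {f = f} {g} f-inj g-inj f#g {i} {i′} fgi≡fgi′
  with splitView m i | splitView m i′
... | left a  | left a′  =
  cong (_↑ˡ _) (f-inj (trans (sym (lookup-++ˡ f g a)) (trans fgi≡fgi′ (lookup-++ˡ f g a′))))
... | right j | right j′ =
  cong (m ↑ʳ_) (g-inj (trans (sym (lookup-++ʳ f g j)) (trans fgi≡fgi′ (lookup-++ʳ f g j′))))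
... | left a  | right j′ =
  ⊥-elim (f#g a j′ (trans (sym (lookup-++ˡ f g a)) (trans fgi≡fgi′ (lookup-++ʳ f g j′))))
... | right j | left a′  =
  ⊥-elim (f#g a′ j (sym (trans (sym (lookup-++ʳ f g j)) (trans fgi≡fgi′ (lookup-++ˡ f g a′)))))

++ᵛ-∈-++ : {m m′ : ℕ} {f : Fin m → A} {g : Fin m′ → A} {xs ys : List A} →
           (∀ a → f a ∈ xs) → (∀ j → g j ∈ ys) → ∀ i → (f ++ᵛ g) i ∈ xs ++ ys
++ᵛ-∈-++ {m = m} {f = f} {g} {xs} f∈xs g∈ys i with splitView m i
... | left a  = subst (_∈ _) (sym (lookup-++ˡ f g a)) (∈-++⁺ˡ (f∈xs a))
... | right j = subst (_∈ _) (sym (lookup-++ʳ f g j)) (∈-++⁺ʳ xs (g∈ys j))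

weaken : {m : ℕ} → k′ ≤ k → Target m k → Target m k′
weaken k′≤k (sink b)   = sink b
weaken k′≤k (node j p) = node j (≤-trans k′≤k p)

Run-weaken : {P : BP n} {x : Fin n → Bool} {k′≤k : k′ ≤ k} {t : Target (size P) k} {b : Bool} →
             Run P x t b → Run P x (weaken k′≤k t) b
Run-weaken (atSink b)   = atSink b
Run-weaken (step j p r) = step j _ r

gate : Bool → Bool → Bool → Bool
gate true  = _∧_
gate false = _∨_

-- Reaching sink b of the first operand of gate c: either b is already the
-- value of the gate, or the second operand, entered at t, decides it.
divert : {m : ℕ} → Bool → Bool → Target m k → Target m k
divert true  true  t = t
divert true  false t = sink false
divert false false t = t
divert false true  t = sink true

Run-divert : {P : BP n} {x : Fin n → Bool} (c b : Bool) {t : Target (size P) k} {d : Bool} →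
             Run P x t d → Run P x (divert c b t) (gate c b d)
Run-divert true  true  r = r
Run-divert true  false r = atSink false
Run-divert false false r = r
Run-divert false true  r = atSink true

query : Fin n → (Bool → Bool) → BP n
query i g = record
  { size   = 1
  ; label  = λ _ → i
  ; edge   = λ _ b → sink (g b)
  ; source = node fzero z≤n
  }

query-onceAppearance : (i : Fin n) (g : Bool → Bool) → OnceAppearance (query i g)
query-onceAppearance i g {fzero} {fzero} _ = refl

query-computes : (i : Fin n) (g : Bool → Bool) → ComputesBP (query i g) (λ x → g (x i))
query-computes i g x = step fzero z≤n (atSink _)

module Plug (c : Bool) (P Q : BP n) where

  private
    m  = size P
    m′ = size Q

  shift : Target m′ k → Target (m + m′) (m + k)
  shift (sink b)   = sink b
  shift (node j p) = node (m ↑ʳ j) (≤-trans (+-monoʳ-≤ m p) (≤-reflexive (sym (toℕ-↑ʳ m j))))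

  entry : k ≤ m → Target (m + m′) k
  entry k≤m = weaken (≤-trans k≤m (m≤m+n m 0)) (shift (source Q))

  lift : k ≤ m → Target m k → Target (m + m′) k
  lift k≤m (sink b)   = divert c b (entry k≤m)
  lift k≤m (node j p) = node (j ↑ˡ m′) (≤-trans p (≤-reflexive (sym (toℕ-↑ˡ j m′))))

  edgeAt : {i : Fin (m + m′)} → SplitView m m′ i → Bool → Target (m + m′) (suc (toℕ i))
  edgeAt (left a)  b = weaken (≤-reflexive (cong suc (toℕ-↑ˡ a m′)))
                              (lift (toℕ<n a) (edge P a b))
  edgeAt (right j) b = weaken (≤-reflexive (trans (cong suc (toℕ-↑ʳ m j)) (sym (+-suc m (toℕ j)))))
                              (shift (edge Q j b))

  plug : BP n
  plug = record
    { size   = m + m′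
    ; label  = label P ++ᵛ label Q
    ; edge   = λ i → edgeAt (splitView m i)
    ; source = lift z≤n (source P)
    }

  plug-onceAppearance : OnceAppearance P → OnceAppearance Q →
                        (∀ a j → label P a ≢ label Q j) → OnceAppearance plug
  plug-onceAppearance = ++ᵛ-injective

  module _ (x : Fin n → Bool) where

    step-↑ˡ : (a : Fin m) {p : k ≤ toℕ (a ↑ˡ m′)} {d : Bool} →
              Run plug x (lift (toℕ<n a) (edge P a (x (label P a)))) d →
              Run plug x (node (a ↑ˡ m′) p) d
    step-↑ˡ a r = step (a ↑ˡ m′) _ (subst (λ t → Run plug x t _) (sym edge≡) (Run-weaken r))
      where
      edge≡ : edge plug (a ↑ˡ m′) (x (label plug (a ↑ˡ m′))) ≡ edgeAt (left a) (x (label P a))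
      edge≡ rewrite splitView-↑ˡ m′ a | lookup-++ˡ (label P) (label Q) a = refl

    step-↑ʳ : (j : Fin m′) {p : k ≤ toℕ (m ↑ʳ j)} {d : Bool} →
              Run plug x (shift (edge Q j (x (label Q j)))) d →
              Run plug x (node (m ↑ʳ j) p) d
    step-↑ʳ j r = step (m ↑ʳ j) _ (subst (λ t → Run plug x t _) (sym edge≡) (Run-weaken r))
      where
      edge≡ : edge plug (m ↑ʳ j) (x (label plug (m ↑ʳ j))) ≡ edgeAt (right j) (x (label Q j))
      edge≡ rewrite splitView-↑ʳ m j | lookup-++ʳ (label P) (label Q) j = refl

    Run-shift : {t : Target m′ k} {d : Bool} → Run Q x t d → Run plug x (shift t) d
    Run-shift (atSink d)   = atSink d
    Run-shift (step j p r) = step-↑ʳ j (Run-shift r)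

    Run-lift : (k≤m : k ≤ m) {t : Target m k} {b d : Bool} →
               Run P x t b → Run Q x (source Q) d → Run plug x (lift k≤m t) (gate c b d)
    Run-lift k≤m (atSink b)   rQ = Run-divert c b (Run-weaken (Run-shift rQ))
    Run-lift k≤m (step a p r) rQ = step-↑ˡ a (Run-lift (toℕ<n a) r rQ)

  plug-computes : {f g : BoolFun n} → ComputesBP P f → ComputesBP Q g →
                  ComputesBP plug (λ x → gate c (f x) (g x))
  plug-computes P⊨f Q⊨g x = Run-lift x z≤n (P⊨f x) (Q⊨g x)

open Plug using (plug; plug-onceAppearance; plug-computes)

toBP : Formula n → BP n
toBP (pos i)   = query i id
toBP (neg i)   = query i not
toBP (and φ ψ) = plug true  (toBP φ) (toBP ψ)
toBP (or φ ψ)  = plug false (toBP φ) (toBP ψ)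

toBP-computes : (φ : Formula n) → ComputesBP (toBP φ) (evalF φ)
toBP-computes (pos i)   = query-computes i id
toBP-computes (neg i)   = query-computes i not
toBP-computes (and φ ψ) = plug-computes true  (toBP φ) (toBP ψ) (toBP-computes φ) (toBP-computes ψ)
toBP-computes (or φ ψ)  = plug-computes false (toBP φ) (toBP ψ) (toBP-computes φ) (toBP-computes ψ)

label-toBP-∈-vars : (φ : Formula n) (i : Fin (size (toBP φ))) → label (toBP φ) i ∈ vars φ
label-toBP-∈-vars (pos i)   _ = here refl
label-toBP-∈-vars (neg i)   _ = here refl
label-toBP-∈-vars (and φ ψ)   = ++ᵛ-∈-++ (label-toBP-∈-vars φ) (label-toBP-∈-vars ψ)
label-toBP-∈-vars (or φ ψ)    = ++ᵛ-∈-++ (label-toBP-∈-vars φ) (label-toBP-∈-vars ψ)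

label-toBP-disjoint : (φ ψ : Formula n) → Disjoint (vars φ) (vars ψ) →
                      ∀ a j → label (toBP φ) a ≢ label (toBP ψ) j
label-toBP-disjoint φ ψ φ#ψ a j a≡j =
  φ#ψ (label-toBP-∈-vars φ a , subst (_∈ vars ψ) (sym a≡j) (label-toBP-∈-vars ψ j))

toBP-onceAppearance : (φ : Formula n) → ReadOnce φ → OnceAppearance (toBP φ)
toBP-onceAppearance (pos i)   _ = query-onceAppearance i id
toBP-onceAppearance (neg i)   _ = query-onceAppearance i not
toBP-onceAppearance (and φ ψ) φψ! with Unique-++⁻ (vars φ) φψ!
... | φ! , ψ! , φ#ψ = plug-onceAppearance true (toBP φ) (toBP ψ)
  (toBP-onceAppearance φ φ!) (toBP-onceAppearance ψ ψ!) (label-toBP-disjoint φ ψ φ#ψ)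
toBP-onceAppearance (or φ ψ)  φψ! with Unique-++⁻ (vars φ) φψ!
... | φ! , ψ! , φ#ψ = plug-onceAppearance false (toBP φ) (toBP ψ)
  (toBP-onceAppearance φ φ!) (toBP-onceAppearance ψ ψ!) (label-toBP-disjoint φ ψ φ#ψ)

proposition1 : (n : ℕ) (f : BoolFun n) →
    (Σ (Formula n) λ φ → ReadOnce φ × (∀ x → evalF φ x ≡ f x)) →
    Σ (BP n) λ P → OnceAppearance P × ComputesBP P f
proposition1 n f (φ , φ-readOnce , φ≗f) =
  toBP φ , toBP-onceAppearance φ φ-readOnce ,
  λ x → subst (Run (toBP φ) x (source (toBP φ))) (φ≗f x) (toBP-computes φ x)
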